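{- Let $p$ be a prime and let $\alpha\in\mathbf{Bad}$ with $\alpha>0$. Assume there is a sequence of natural numbers $\{\ell_m\}_{m\in\mathbb{N}}$ such that, for every $m\in\mathbb{N}$, $p^{\ell_m}\alpha$ is not an infinite loop mod $p^m$. Then $\alpha$ satisfies the $p$-adic Littlewood Conjecture, i.e. $m_p(\alpha)=0$.
   Context: $\|x\|$ is the distance from $x$ to the nearest integer, $|\cdot|_p$ the $p$-adic absolute value, and $m_p(\alpha):=\inf_{q\in\mathbb{N}} q\,|q|_p\,\|q\alpha\|$. $\mathbf{Bad}$ is the set of irrational reals whose continued fraction expansion has bounded partial quotients (excluding $a_0$). For $\alpha>0$ with continued fraction expansion $[a_0;a_1,a_2,\ldots]$, the convergent denominators are $q_{ -1}=0$, $q_0=1$, $q_k=a_kq_{k-1}+q_{k-2}$, and the semi-convergent denominators are $q_{\{k,m\}}=mq_k+q_{k-1}$ for $k\ge0$ and integers $0\le m\le a_{k+1}$. For $n\in\mathbb{N}$, $\alpha>0$ is an infinite loop mod $n$ if none of its semi-convergent denominators is divisible by $n$, apart from $q_{ -1}=0$. -}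

module Defs where

open import Data.Nat using (ℕ; zero; suc; _+_; _*_; _∸_; _^_; _≤_; _<_)
open import Data.Nat.Divisibility using (_∣_)
open import Data.Nat.Primality using (Prime)
open import Data.Product using (Σ; ∃; ∃-syntax; _×_; _,_; proj₁; proj₂)
open import Data.Sum using (_⊎_)
open import Relation.Nullary using (¬_)
open import Relation.Binary.PropositionalEquality using (_≡_)

-- A positive irrational real α is represented by its (infinite) continued
-- fraction expansion  a : ℕ → ℕ,  α = [a 0; a 1, a 2, ...]  with a (suc i) ≥ 1.
CF : Set
CF = ℕ → ℕ

ValidCF : CF → Set
ValidCF a = ∀ i → 1 ≤ a (suc i)

InBad : CF → Set
InBad a = ∃[ B ] (∀ i → a (suc i) ≤ B)

-- (q_{k-1}, q_k) and (p_{k-1}, p_k), starting from (q_{-1},q_0) = (0,1),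
-- (p_{-1},p_0) = (1,a₀).
qPair : CF → ℕ → ℕ × ℕ
qPair a zero = 0 , 1
qPair a (suc k) = proj₂ (qPair a k) , a (suc k) * proj₂ (qPair a k) + proj₁ (qPair a k)

pPair : CF → ℕ → ℕ × ℕ
pPair a zero = 1 , a 0
pPair a (suc k) = proj₂ (pPair a k) , a (suc k) * proj₂ (pPair a k) + proj₁ (pPair a k)

den : CF → ℕ → ℕ
den a k = proj₂ (qPair a k)

denPrev : CF → ℕ → ℕ
denPrev a k = proj₁ (qPair a k)

num : CF → ℕ → ℕ
num a k = proj₂ (pPair a k)

numPrev : CF → ℕ → ℕ
numPrev a k = proj₁ (pPair a k)

semiDen : CF → ℕ → ℕ → ℕ
semiDen a k m = m * den a k + denPrev a k

-- The irrationals with expansion starting [a₀; a₁, …, a_n] form the open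
-- interval with endpoints [a₀;…,a_n] = p_n/q_n and [a₀;…,a_n + 1] =
-- (p_n+p_{n-1})/(q_n+q_{n-1}).  Comparisons of α with a nonnegative
-- rational u/v (v > 0):
--   u/v < α  iff  u/v lies below both endpoints of some prefix interval,
--   α < u/v  iff  u/v lies above both endpoints of some prefix interval.
RatLt : ℕ → ℕ → CF → Set
RatLt u v a = ∃[ n ] ((u * den a n < num a n * v)
  × (u * (den a n + denPrev a n) < (num a n + numPrev a n) * v))

LtRat : CF → ℕ → ℕ → Set
LtRat a u v = ∃[ n ] ((num a n * v < u * den a n)
  × ((num a n + numPrev a n) * v < u * (den a n + denPrev a n)))

-- b is the continued fraction expansion of the real c·α (c ≥ 1):
-- b is a valid expansion and c·α lies strictly inside every prefix interval
-- of b.  (Using  r < c·α ⇔ r/c < α.)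
IsCFOfScaled : CF → ℕ → CF → Set
IsCFOfScaled b c a = ValidCF b × (∀ n →
    (RatLt (num b n) (den b n * c) a
       × LtRat a (num b n + numPrev b n) ((den b n + denPrev b n) * c))
  ⊎ (RatLt (num b n + numPrev b n) ((den b n + denPrev b n) * c) a
       × LtRat a (num b n) (den b n * c)))

-- infinite loop mod n: no semi-convergent denominator q_{k,m}
-- (k ≥ 0, 0 ≤ m ≤ b_{k+1}), apart from q_{0,0} = q_{-1} = 0, is divisible by n.
InfiniteLoop : ℕ → CF → Set
InfiniteLoop n b = ∀ k m → m ≤ b (suc k) → ¬ (k ≡ 0 × m ≡ 0) → ¬ (n ∣ semiDen b k m)

-- "not an infinite loop mod n", in positive (classically equivalent) form.
NotInfiniteLoop : ℕ → CF → Set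
NotInfiniteLoop n b = ∃[ k ] ∃[ m ] (m ≤ b (suc k) × ¬ (k ≡ 0 × m ≡ 0) × n ∣ semiDen b k m)

-- q |q|_p = r  where  q = p^j r,  p ∤ r.
PFreePart : ℕ → ℕ → ℕ → Set
PFreePart p q r = ∃[ j ] (q ≡ p ^ j * r × ¬ (p ∣ r))

-- m_p(α) = 0 : for every rational ε = e/f > 0 there is q ≥ 1 with
-- q |q|_p ‖qα‖ < ε, i.e. with r = q|q|_p and some integer N ≥ 0:
-- |qα - N| < e/(f r), i.e.  (N f r - e)/(f r q) < α < (N f r + e)/(f r q)
-- (truncated subtraction: if N f r ≤ e the lower bound is 0 < α, which holds).
pLittlewood : ℕ → CF → Set
pLittlewood p a = ∀ e f → 1 ≤ e → 1 ≤ f →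
  ∃[ q ] ∃[ r ] ∃[ N ] (1 ≤ q × PFreePart p q r
    × RatLt (N * f * r ∸ e) (f * r * q) a
    × LtRat a (N * f * r + e) (f * r * q))

{-# OPTIONS --safe #-}
module Submission where

-- Let b be the expansion of c α, c = p^ℓ, and let p^m with m = f² + 1 divide a semi-convergent
-- denominator q_{k,j} of b.  Since |q_k p_{k-1} - p_k q_{k-1}| = 1, the fraction p_{k,j}/q_{k,j}
-- is within (b_{k+1} - j + 1)/(q_{k,j} q_{k+1}) of both endpoints of the prefix interval of
-- [b₀; …, b_{k+1}], which contains c α.  If b_{k+1} < f, then q = c q_{k,j} has
-- q |q|_p ‖q α‖ ≤ f r / q_{k+1} with r ≤ q_{k,j} / p^m < q_{k,j} / f², hence < 1/f.  If
-- b_{k+1} ≥ f, the convergent already gives q |q|_p ‖q α‖ < q_k / q_{k+1} ≤ 1/f for q = c q_k.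

open import Defs
open import Data.Nat using (ℕ; zero; suc; _+_; _*_; _∸_; _^_; _≤_; _<_; ∣_-_∣;
  z≤n; s≤s; z<s; >-nonZero; nonTrivial⇒n>1)
open import Data.Nat.Properties
open import Data.Nat.Divisibility using (_∣_; divides; _∣?_)
open import Data.Nat.Induction using (<-wellFounded)
open import Data.Nat.Primality using (Prime; prime⇒nonTrivial)
open import Data.Nat.Tactic.RingSolver using (solve-∀)
open import Data.Product using (∃-syntax; _×_; _,_; proj₁; proj₂)
open import Data.Sum using (_⊎_; inj₁; inj₂)
open import Data.Empty using (⊥-elim)
open import Induction.WellFounded using (Acc; acc)
open import Relation.Nullary using (¬_; yes; no)
open import Relation.Binary.PropositionalEquality

∣-∣-cross-≤ : ∀ L₁ L₂ x y U V → y ≤ x → U ≤ V →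
  L₁ + (x * V + y * U) ≡ L₂ + (x * U + y * V) → ∣ L₁ - L₂ ∣ ≡ ∣ x - y ∣ * ∣ U - V ∣
∣-∣-cross-≤ L₁ L₂ x y U V y≤x U≤V eq
  with s , refl ← m≤n⇒∃[o]m+o≡n y≤x
     | t , refl ← m≤n⇒∃[o]m+o≡n U≤V = begin
  ∣ L₁ - L₂ ∣                    ≡⟨ cong ∣ L₁ -_∣ L₂≡L₁+st ⟩
  ∣ L₁ - L₁ + s * t ∣            ≡⟨ ∣m-m+n∣≡n L₁ (s * t) ⟩
  s * t                          ≡⟨ cong₂ _*_ ∣y+s-y∣≡s (∣m-m+n∣≡n U t) ⟨
  ∣ y + s - y ∣ * ∣ U - U + t ∣  ∎
  where
  open ≡-Reasoning
  K = (y + s) * U + y * (U + t)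
  expand : ∀ L y s U t → L + ((y + s) * (U + t) + y * U) ≡ L + s * t + ((y + s) * U + y * (U + t))
  expand = solve-∀
  L₂≡L₁+st : L₂ ≡ L₁ + s * t
  L₂≡L₁+st = +-cancelʳ-≡ K L₂ (L₁ + s * t) (trans (sym eq) (expand L₁ y s U t))
  ∣y+s-y∣≡s : ∣ y + s - y ∣ ≡ s
  ∣y+s-y∣≡s = trans (∣-∣-comm (y + s) y) (∣m-m+n∣≡n y s)

-- L₁ - L₂ = (x - y)(U - V), read off an equation that avoids subtraction.
∣-∣-cross : ∀ L₁ L₂ x y U V → L₁ + (x * V + y * U) ≡ L₂ + (x * U + y * V) →
  ∣ L₁ - L₂ ∣ ≡ ∣ x - y ∣ * ∣ U - V ∣
∣-∣-cross L₁ L₂ x y U V eq with ≤-total y x | ≤-total U V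
... | inj₁ y≤x | inj₁ U≤V = ∣-∣-cross-≤ L₁ L₂ x y U V y≤x U≤V eq
... | inj₁ y≤x | inj₂ V≤U = flip-both (∣-∣-cross-≤ L₂ L₁ x y V U y≤x V≤U (sym eq))
  where
  flip-both : ∣ L₂ - L₁ ∣ ≡ ∣ x - y ∣ * ∣ V - U ∣ → ∣ L₁ - L₂ ∣ ≡ ∣ x - y ∣ * ∣ U - V ∣
  flip-both e = trans (∣-∣-comm L₁ L₂) (trans e (cong (∣ x - y ∣ *_) (∣-∣-comm V U)))
... | inj₂ x≤y | inj₁ U≤V = flip-both (∣-∣-cross-≤ L₂ L₁ y x U V x≤y U≤V eq′)
  where
  eq′ : L₂ + (y * V + x * U) ≡ L₁ + (y * U + x * V)
  eq′ = trans (cong (L₂ +_) (+-comm (y * V) (x * U)))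
          (trans (sym eq) (cong (L₁ +_) (+-comm (x * V) (y * U))))
  flip-both : ∣ L₂ - L₁ ∣ ≡ ∣ y - x ∣ * ∣ U - V ∣ → ∣ L₁ - L₂ ∣ ≡ ∣ x - y ∣ * ∣ U - V ∣
  flip-both e = trans (∣-∣-comm L₁ L₂) (trans e (cong (_* ∣ U - V ∣) (∣-∣-comm y x)))
... | inj₂ x≤y | inj₂ V≤U = flip-both (∣-∣-cross-≤ L₁ L₂ y x V U x≤y V≤U eq′)
  where
  eq′ : L₁ + (y * U + x * V) ≡ L₂ + (y * V + x * U)
  eq′ = trans (cong (L₁ +_) (+-comm (y * U) (x * V)))
          (trans eq (cong (L₂ +_) (+-comm (x * U) (y * V))))
  flip-both : ∣ L₁ - L₂ ∣ ≡ ∣ y - x ∣ * ∣ V - U ∣ → ∣ L₁ - L₂ ∣ ≡ ∣ x - y ∣ * ∣ U - V ∣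
  flip-both e = trans e (cong₂ _*_ (∣-∣-comm y x) (∣-∣-comm V U))

∣m-n∣≤o : ∀ {m n o} → m ≤ o → n ≤ o → ∣ m - n ∣ ≤ o
∣m-n∣≤o {m} {n} m≤o n≤o = ≤-trans (∣m-n∣≤m⊔n m n) (⊔-lub m≤o n≤o)

1<m⇒0<m^n : ∀ {m} → 1 < m → ∀ n → 0 < m ^ n
1<m⇒0<m^n 1<m n = m^n>0 _ {{>-nonZero (<-trans z<s 1<m)}} n

n<m^n : ∀ {m} → 1 < m → ∀ n → n < m ^ n
n<m^n 1<m zero    = z<s
n<m^n 1<m (suc n) = ≤-<-trans (n<m^n 1<m n) (^-monoʳ-< _ 1<m (n<1+n n))

semiNum : CF → ℕ → ℕ → ℕ
semiNum a k m = m * num a k + numPrev a k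

unimodular : (b : CF) → ∀ k → ∣ numPrev b k * den b k - denPrev b k * num b k ∣ ≡ 1
convergent-distance : (b : CF) → ∀ k i →
  ∣ den b k * semiNum b k i - num b k * semiDen b k i ∣ ≡ 1

unimodular b zero    = refl
unimodular b (suc k) =
  trans (∣-∣-comm (num b k * semiDen b k (b (suc k))) _) (convergent-distance b k (b (suc k)))

convergent-distance b k i =
  trans (∣-∣-cross (den b k * semiNum b k i) (num b k * semiDen b k i) 1 0
                    (numPrev b k * den b k) (denPrev b k * num b k)
                    (cross-identity (den b k) (denPrev b k) (num b k) (numPrev b k) i))
        (trans (*-identityˡ _) (unimodular b k))
  where
  cross-identity : ∀ D q′ B p′ i →
    D * (i * B + p′) + (1 * (q′ * B) + 0 * (p′ * D))
      ≡ B * (i * D + q′) + (1 * (p′ * D) + 0 * (q′ * B))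
  cross-identity = solve-∀

semiconvergent-distance : (b : CF) → ∀ k i j →
  ∣ semiDen b k j * semiNum b k i - semiNum b k j * semiDen b k i ∣ ≡ ∣ j - i ∣
semiconvergent-distance b k i j =
  trans (∣-∣-cross (semiDen b k j * semiNum b k i) (semiNum b k j * semiDen b k i) j i
                    (numPrev b k * den b k) (denPrev b k * num b k)
                    (cross-identity (den b k) (denPrev b k) (num b k) (numPrev b k) i j))
        (trans (cong (∣ j - i ∣ *_) (unimodular b k)) (*-identityʳ _))
  where
  cross-identity : ∀ D q′ B p′ i j →
    (j * D + q′) * (i * B + p′) + (j * (q′ * B) + i * (p′ * D))
      ≡ (j * B + p′) * (i * D + q′) + (j * (p′ * D) + i * (q′ * B))
  cross-identity = solve-∀

semiDen-suc : (a : CF) → ∀ k m → semiDen a k (suc m) ≡ semiDen a k m + den a k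
semiDen-suc a k m = shift m (den a k) (denPrev a k)
  where
  shift : ∀ m D q′ → suc m * D + q′ ≡ m * D + q′ + D
  shift = solve-∀

semiNum-suc : (a : CF) → ∀ k m → semiNum a k (suc m) ≡ semiNum a k m + num a k
semiNum-suc a k m = shift m (num a k) (numPrev a k)
  where
  shift : ∀ m B p′ → suc m * B + p′ ≡ m * B + p′ + B
  shift = solve-∀

semiDen-mono : (a : CF) → ∀ k {m n} → m ≤ n → semiDen a k m ≤ semiDen a k n
semiDen-mono a k m≤n = +-monoˡ-≤ (denPrev a k) (*-monoˡ-≤ (den a k) m≤n)

den-pos : ∀ {b} → ValidCF b → ∀ k → 1 ≤ den b k
den-pos valid zero    = ≤-refl
den-pos valid (suc k) = ≤-trans (*-mono-≤ (valid k) (den-pos valid k)) (m≤m+n _ _)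

semiDen-pos : ∀ {b} → ValidCF b → ∀ k j → ¬ (k ≡ 0 × j ≡ 0) → 1 ≤ semiDen b k j
semiDen-pos valid (suc k) j       _       = ≤-trans (den-pos valid k) (m≤n+m _ _)
semiDen-pos valid zero    (suc j) _       = s≤s z≤n
semiDen-pos valid zero    zero    nonzero = ⊥-elim (nonzero (refl , refl))

Separates : CF → ℕ → ℕ → ℕ → ℕ → Set
Separates a y₁ w₁ y₂ w₂ = (RatLt y₁ w₁ a × LtRat a y₂ w₂) ⊎ (RatLt y₂ w₂ a × LtRat a y₁ w₁)

record InRange (L U W y w : ℕ) : Set where
  constructor between
  field
    lower : L * w ≤ y * W
    upper : y * W ≤ U * w

prefix-interval : ∀ {a b c} → IsCFOfScaled b c a → ∀ k →
  Separates a (semiNum b k (b (suc k))) (semiDen b k (b (suc k)) * c)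
              (semiNum b k (suc (b (suc k)))) (semiDen b k (suc (b (suc k))) * c)
prefix-interval {b = b} (_ , inside) k
  rewrite semiNum-suc b k (b (suc k)) | semiDen-suc b k (b (suc k)) = inside (suc k)

≤-<-trans-frac : ∀ u v u′ v′ y x → 0 < v′ → u′ * v ≤ u * v′ → u * x < y * v → u′ * x < y * v′
≤-<-trans-frac u v u′ v′ y x 0<v′ le lt = *-cancelʳ-< v (u′ * x) (y * v′) (begin-strict
  u′ * x * v  ≡⟨ solve₁ u′ x v ⟩
  u′ * v * x  ≤⟨ *-monoˡ-≤ x le ⟩
  u * v′ * x  ≡⟨ solve₁ u v′ x ⟩
  u * x * v′  <⟨ *-monoˡ-< v′ {{>-nonZero 0<v′}} lt ⟩
  y * v * v′  ≡⟨ solve₁ y v v′ ⟩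
  y * v′ * v  ∎)
  where
  open ≤-Reasoning
  solve₁ : ∀ a b c → a * b * c ≡ a * c * b
  solve₁ = solve-∀

<-≤-trans-frac : ∀ u v u′ v′ y x → 0 < v′ → u * v′ ≤ u′ * v → y * v < u * x → y * v′ < u′ * x
<-≤-trans-frac u v u′ v′ y x 0<v′ le lt = *-cancelʳ-< v (y * v′) (u′ * x) (begin-strict
  y * v′ * v  ≡⟨ solve₁ y v′ v ⟩
  y * v * v′  <⟨ *-monoˡ-< v′ {{>-nonZero 0<v′}} lt ⟩
  u * x * v′  ≡⟨ solve₁ u x v′ ⟩
  u * v′ * x  ≤⟨ *-monoˡ-≤ x le ⟩
  u′ * v * x  ≡⟨ solve₁ u′ v x ⟩
  u′ * x * v  ∎)
  where
  open ≤-Reasoning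
  solve₁ : ∀ a b c → a * b * c ≡ a * c * b
  solve₁ = solve-∀

ratLt-mono : ∀ {a} u v u′ v′ → 0 < v′ → u′ * v ≤ u * v′ → RatLt u v a → RatLt u′ v′ a
ratLt-mono {a} u v u′ v′ 0<v′ le (n , below₁ , below₂) =
  n , ≤-<-trans-frac u v u′ v′ (num a n) (den a n) 0<v′ le below₁
    , ≤-<-trans-frac u v u′ v′ (num a n + numPrev a n) (den a n + denPrev a n) 0<v′ le below₂

ltRat-mono : ∀ {a} u v u′ v′ → 0 < v′ → u * v′ ≤ u′ * v → LtRat a u v → LtRat a u′ v′
ltRat-mono {a} u v u′ v′ 0<v′ le (n , above₁ , above₂) =
  n , <-≤-trans-frac u v u′ v′ (num a n) (den a n) 0<v′ le above₁
    , <-≤-trans-frac u v u′ v′ (num a n + numPrev a n) (den a n + denPrev a n) 0<v′ le above₂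

separates⇒bounds : ∀ {a L U W y₁ w₁ y₂ w₂} → 0 < W →
  InRange L U W y₁ w₁ → InRange L U W y₂ w₂ → Separates a y₁ w₁ y₂ w₂ →
  RatLt L W a × LtRat a U W
separates⇒bounds {L = L} {U} {W} {y₁} {w₁} {y₂} {w₂} 0<W
  (between lo₁ hi₁) (between lo₂ hi₂) (inj₁ (y₁<α , α<y₂)) =
  ratLt-mono y₁ w₁ L W 0<W lo₁ y₁<α , ltRat-mono y₂ w₂ U W 0<W hi₂ α<y₂
separates⇒bounds {L = L} {U} {W} {y₁} {w₁} {y₂} {w₂} 0<W
  (between lo₁ hi₁) (between lo₂ hi₂) (inj₂ (y₂<α , α<y₁)) =
  ratLt-mono y₂ w₂ L W 0<W lo₂ y₂<α , ltRat-mono y₁ w₁ U W 0<W hi₁ α<y₁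

inRange-scale : ∀ {L U W y w} c → InRange L U W y w → InRange L U (W * c) y (w * c)
inRange-scale {L} {U} {W} {y} {w} c (between lo hi) = between
  (subst₂ _≤_ (*-assoc L w c) (*-assoc y W c) (*-monoˡ-≤ c lo))
  (subst₂ _≤_ (*-assoc y W c) (*-assoc U w c) (*-monoˡ-≤ c hi))

-- If |Q y - N w| ≤ d then |y/w - N/Q| ≤ d/(Q w), which is at most e/(g Q) when g d ≤ e w.
distance⇒inRange : ∀ Q N y w g e {d} → ∣ Q * y - N * w ∣ ≤ d → g * d ≤ e * w →
  InRange (N * g ∸ e) (N * g + e) (g * Q) y w
distance⇒inRange Q N y w g e {d} dist gd≤ew = between lower upper
  where
  open ≤-Reasoning
  Qy≤Nw+d : Q * y ≤ N * w + d
  Qy≤Nw+d = ≤-trans (m≤n+∣m-n∣ (Q * y) (N * w)) (+-monoʳ-≤ (N * w) dist)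
  Nw≤Qy+d : N * w ≤ Q * y + d
  Nw≤Qy+d = ≤-trans (m≤n+∣n-m∣ (N * w) (Q * y)) (+-monoʳ-≤ (Q * y) dist)
  regroup₁ : ∀ g N w → g * (N * w) ≡ N * g * w
  regroup₁ = solve-∀
  regroup₂ : ∀ g Q y d → g * (Q * y + d) ≡ y * (g * Q) + g * d
  regroup₂ = solve-∀
  regroup₃ : ∀ g N w d → g * (N * w + d) ≡ N * g * w + g * d
  regroup₃ = solve-∀
  lower : (N * g ∸ e) * w ≤ y * (g * Q)
  lower = begin
    (N * g ∸ e) * w            ≡⟨ *-distribʳ-∸ w (N * g) e ⟩
    N * g * w ∸ e * w          ≡⟨ cong (_∸ e * w) (regroup₁ g N w) ⟨
    g * (N * w) ∸ e * w        ≤⟨ ∸-monoˡ-≤ (e * w) (*-monoʳ-≤ g Nw≤Qy+d) ⟩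
    g * (Q * y + d) ∸ e * w    ≡⟨ cong (_∸ e * w) (regroup₂ g Q y d) ⟩
    y * (g * Q) + g * d ∸ e * w ≤⟨ ∸-monoʳ-≤ (y * (g * Q) + g * d) gd≤ew ⟩
    y * (g * Q) + g * d ∸ g * d ≡⟨ m+n∸n≡m (y * (g * Q)) (g * d) ⟩
    y * (g * Q)                ∎
  upper : y * (g * Q) ≤ (N * g + e) * w
  upper = begin
    y * (g * Q)           ≡⟨ solve-yQ g Q y ⟩
    g * (Q * y)           ≤⟨ *-monoʳ-≤ g Qy≤Nw+d ⟩
    g * (N * w + d)       ≡⟨ regroup₃ g N w d ⟩
    N * g * w + g * d     ≤⟨ +-monoʳ-≤ (N * g * w) gd≤ew ⟩
    N * g * w + e * w     ≡⟨ *-distribʳ-+ w (N * g) e ⟨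
    (N * g + e) * w       ∎
    where
    solve-yQ : ∀ g Q y → y * (g * Q) ≡ g * (Q * y)
    solve-yQ = solve-∀

pFreePart-exists : ∀ {p} → 1 < p → ∀ n → 0 < n → ∃[ r ] PFreePart p n r
pFreePart-exists {p} 1<p n = go n (<-wellFounded n)
  where
  regroup : ∀ x r p → x * r * p ≡ p * x * r
  regroup = solve-∀
  go : ∀ n → Acc _<_ n → 0 < n → ∃[ r ] PFreePart p n r
  go n (acc rec) 0<n with p ∣? n
  ... | no p∤n = n , 0 , sym (*-identityˡ n) , p∤n
  ... | yes (divides zero n≡0) = ⊥-elim (<⇒≢ 0<n (sym n≡0))
  ... | yes (divides m@(suc _) n≡m*p)
    with r , j , m≡pʲr , p∤r ← go m (rec (subst (m <_) (sym n≡m*p) (m<m*n m p 1<p))) z<s =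
    r , suc j , trans n≡m*p (trans (cong (_* p) m≡pʲr) (regroup (p ^ j) r p)) , p∤r

pFreePart-*-pow : ∀ {p n r} s → PFreePart p n r → PFreePart p (n * p ^ s) r
pFreePart-*-pow {p} {n} {r} s (j , n≡pʲr , p∤r) = j + s , (begin
  n * p ^ s            ≡⟨ cong (_* p ^ s) n≡pʲr ⟩
  p ^ j * r * p ^ s    ≡⟨ regroup (p ^ j) r (p ^ s) ⟩
  p ^ j * p ^ s * r    ≡⟨ cong (_* r) (^-distribˡ-+-* p j s) ⟨
  p ^ (j + s) * r      ∎) , p∤r
  where
  open ≡-Reasoning
  regroup : ∀ x r y → x * r * y ≡ x * y * r
  regroup = solve-∀

pFreePart-≤ : ∀ {p n r} → 1 < p → PFreePart p n r → r ≤ n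
pFreePart-≤ {p} {n} {r} 1<p (j , n≡pʲr , _) = begin
  r            ≡⟨ *-identityˡ r ⟨
  1 * r        ≤⟨ *-monoˡ-≤ r (1<m⇒0<m^n 1<p j) ⟩
  p ^ j * r    ≡⟨ n≡pʲr ⟨
  n            ∎
  where open ≤-Reasoning

pFreePart-pos : ∀ {p n r} → PFreePart p n r → 0 < r
pFreePart-pos {r = zero}  (_ , _ , p∤0) = ⊥-elim (p∤0 (divides 0 refl))
pFreePart-pos {r = suc _} _             = z<s

LittlewoodWitness : ℕ → CF → ℕ → ℕ → Set
LittlewoodWitness p a e f = ∃[ q ] ∃[ r ] ∃[ N ] (1 ≤ q × PFreePart p q r
  × RatLt (N * f * r ∸ e) (f * r * q) a × LtRat a (N * f * r + e) (f * r * q))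

-- c α lies between the endpoints y/w of the prefix interval of [b₀; …, b_{k+1}], so
-- |Q c α - N| is at most the larger of the |Q y - N w|/w.
witness-from-endpoints : ∀ {p a b c e f r d} k Q N → IsCFOfScaled b c a → 0 < c → 1 ≤ e → 1 ≤ f →
  0 < Q → PFreePart p (Q * c) r →
  ∣ Q * semiNum b k (b (suc k)) - N * semiDen b k (b (suc k)) ∣ ≤ d →
  ∣ Q * semiNum b k (suc (b (suc k))) - N * semiDen b k (suc (b (suc k))) ∣ ≤ d →
  f * r * d ≤ semiDen b k (b (suc k)) → LittlewoodWitness p a e f
witness-from-endpoints {p} {a} {b} {c} {e} {f} {r} {d} k Q N
    cf 0<c 1≤e 1≤f 0<Q free dist₁ dist₂ frd≤w₁ =
  Q * c , r , N , *-mono-≤ 0<Q 0<c , free ,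
  subst₂ (λ L W → RatLt (L ∸ e) W a × LtRat a (L + e) W) (sym (*-assoc N f r)) (*-assoc (f * r) Q c)
    (separates⇒bounds 0<W
      (inRange-scale c (distance⇒inRange Q N (semiNum b k i) w₁ (f * r) e dist₁
        (≤-trans frd≤w₁ (w≤ew w₁))))
      (inRange-scale c (distance⇒inRange Q N (semiNum b k (suc i)) w₂ (f * r) e dist₂
        (≤-trans frd≤w₁ (≤-trans w₁≤w₂ (w≤ew w₂)))))
      (prefix-interval cf k))
  where
  i = b (suc k)
  w₁ = semiDen b k i
  w₂ = semiDen b k (suc i)
  w≤ew : ∀ w → w ≤ e * w
  w≤ew w = m≤n*m w e {{>-nonZero 1≤e}}
  w₁≤w₂ : w₁ ≤ w₂
  w₁≤w₂ = semiDen-mono b k (n≤1+n i)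
  0<W : 0 < f * r * Q * c
  0<W = *-mono-≤ (*-mono-≤ (*-mono-≤ 1≤f (pFreePart-pos free)) 0<Q) 0<c

witness-from-large-quotient : ∀ {p a b s e f} → 1 < p → IsCFOfScaled b (p ^ s) a → 1 ≤ e → 1 ≤ f →
  ∀ k → f ≤ b (suc k) → LittlewoodWitness p a e f
witness-from-large-quotient {p} {a} {b} {s} {e} {f} 1<p cf 1≤e 1≤f k f≤i
  with r , free ← pFreePart-exists 1<p (den b k) (den-pos (proj₁ cf) k) =
  witness-from-endpoints k (den b k) (num b k) cf (1<m⇒0<m^n 1<p s) 1≤e 1≤f
    (den-pos (proj₁ cf) k) (pFreePart-*-pow s free)
    (≤-reflexive (convergent-distance b k i)) (≤-reflexive (convergent-distance b k (suc i)))
    fr≤w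
  where
  open ≤-Reasoning
  i = b (suc k)
  fr≤w : f * r * 1 ≤ semiDen b k i
  fr≤w = begin
    f * r * 1               ≡⟨ *-identityʳ (f * r) ⟩
    f * r                   ≤⟨ *-mono-≤ f≤i (pFreePart-≤ 1<p free) ⟩
    i * den b k             ≤⟨ m≤m+n (i * den b k) (denPrev b k) ⟩
    semiDen b k i           ∎

-- p^m ∣ q_{k,j} with f² < p^m makes r ≤ q_{k,j}/p^m < q_{k,j}/f², which beats the distance f.
witness-from-divisible-semiconvergent : ∀ {p a b s e f} → 1 < p → IsCFOfScaled b (p ^ s) a →
  1 ≤ e → 1 ≤ f → ∀ k j → j ≤ b (suc k) → b (suc k) < f → ¬ (k ≡ 0 × j ≡ 0) →
  p ^ suc (f * f) ∣ semiDen b k j → LittlewoodWitness p a e f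
witness-from-divisible-semiconvergent {p} {a} {b} {s} {e} {f}
    1<p cf 1≤e 1≤f k j j≤i i<f nonzero (divides Q′ Q≡Q′pᵐ) =
  witness-from-endpoints k Q (semiNum b k j) cf (1<m⇒0<m^n 1<p s) 1≤e 1≤f
    0<Q (pFreePart-*-pow s (subst (λ n → PFreePart p n r) (sym Q≡Q′pᵐ) (pFreePart-*-pow m free)))
    (distance≤f i (<⇒≤ i<f)) (distance≤f (suc i) i<f) frf≤w
  where
  open ≤-Reasoning
  i = b (suc k)
  m = suc (f * f)
  Q = semiDen b k j
  0<Q : 0 < Q
  0<Q = semiDen-pos (proj₁ cf) k j nonzero
  0<Q′ : 0 < Q′
  0<Q′ = positive-factor Q′ (subst (0 <_) Q≡Q′pᵐ 0<Q)
    where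
    positive-factor : ∀ x {y} → 0 < x * y → 0 < x
    positive-factor (suc _) _ = z<s
  r : ℕ
  r = proj₁ (pFreePart-exists 1<p Q′ 0<Q′)
  free : PFreePart p Q′ r
  free = proj₂ (pFreePart-exists 1<p Q′ 0<Q′)
  distance≤f : ∀ i′ → i′ ≤ f → ∣ Q * semiNum b k i′ - semiNum b k j * semiDen b k i′ ∣ ≤ f
  distance≤f i′ i′≤f = subst (_≤ f) (sym (semiconvergent-distance b k i′ j))
    (∣m-n∣≤o (≤-trans j≤i (<⇒≤ i<f)) i′≤f)
  f²≤pᵐ : f * f ≤ p ^ m
  f²≤pᵐ = ≤-trans (n≤1+n (f * f)) (<⇒≤ (n<m^n 1<p m))
  regroup : ∀ f r → f * r * f ≡ r * (f * f)
  regroup = solve-∀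
  frf≤w : f * r * f ≤ semiDen b k i
  frf≤w = begin
    f * r * f        ≡⟨ regroup f r ⟩
    r * (f * f)      ≤⟨ *-mono-≤ (pFreePart-≤ 1<p free) f²≤pᵐ ⟩
    Q′ * p ^ m       ≡⟨ Q≡Q′pᵐ ⟨
    Q                ≤⟨ semiDen-mono b k j≤i ⟩
    semiDen b k i    ∎

mainTheorem4 : (p : ℕ) → Prime p → (a : CF) → ValidCF a → InBad a
    → (ℓ : ℕ → ℕ)
    → (∀ m → 1 ≤ m → ∃[ b ] (IsCFOfScaled b (p ^ ℓ m) a × NotInfiniteLoop (p ^ m) b))
    → pLittlewood p a
mainTheorem4 p p-prime a _ _ ℓ not-loop e f 1≤e 1≤f = witness (not-loop m (s≤s z≤n))
  where
  m = suc (f * f)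
  1<p : 1 < p
  1<p = nonTrivial⇒n>1 p {{prime⇒nonTrivial p-prime}}
  witness : ∃[ b ] (IsCFOfScaled b (p ^ ℓ m) a × NotInfiniteLoop (p ^ m) b) →
    LittlewoodWitness p a e f
  witness (b , cf , k , j , j≤i , nonzero , pᵐ∣q) with f ≤? b (suc k)
  ... | yes f≤i = witness-from-large-quotient {s = ℓ m} 1<p cf 1≤e 1≤f k f≤i
  ... | no  f≰i =
    witness-from-divisible-semiconvergent {s = ℓ m} 1<p cf 1≤e 1≤f k j j≤i (≰⇒> f≰i) nonzero pᵐ∣q
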